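{- Let $D'$ be the planar network described below, and for $n,k\ge0$ let $T(n,k)=\sum_{\mathcal{P}\in\mathsf{P}_{n,k}}w(\mathcal{P})$. Apply the specialisations $e_{i,l}\to e$ for all $i,l$, $a_{i,0,l}\to c$ for all $i,l$, and $a_{i,j,l}\to a$ for all $j>0$, where $a,c,e$ are indeterminates. Then the resulting matrix $(T(n,k))_{n,k\ge0}$ coincides with the matrix $\mathbf{T}(a,c,0,e)$ defined by $T(0,k)=\delta_{k0}$ and, for $n\ge1$, $T(n,k)=[a(n-k)+c]\,T(n-1,k-1)+e\,T(n-1,k)$ (with $T(n,k)=0$ for $k<0$).
   Context: Let $\Delta(n)=\binom{n+1}{2}$ for $n\ge0$ (triangular numbers); for a triangular number $t$, $\Delta^{ -1}(t)$ is the unique $n\ge0$ with $\Delta(n)=t$. For an integer $m\ge0$, let $\lceil m\rceil_\Delta$ be the smallest triangular number $\ge m$ and $\delta(m)=\lceil m\rceil_\Delta-m$. Let $\mathcal{A}=\{a_{i,j,l}:(i,j,l)\in\mathbb{N}^3,\ j\le i\}$ and $\mathcal{E}=\{e_{i,l}:(i,l)\in\mathbb{N}^2\}$ be sets of commuting indeterminates. Consider the digraph with vertex set $\{(i,j)\in\mathbb{Z}^2:0\le i\le j\}$ where, for $1\le i\le j$, there is a horizontal edge $(i,j)\to(i-1,j)$ of weight $\alpha_{i,j-i+1}$ and a diagonal edge $(i,j)\to(i-1,j-1)$ of weight $\beta_{i,j-i}$. Here, for $i\ge1,l\ge0$: $\beta_{i,l}=e_{\Delta^{ -1}(i+l-1)-l,\,l}$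 if $i+l-1$ is triangular and $i+l-1\ge\Delta(l)$; $\beta_{i,l}=1$ if $i+l-1$ is not triangular and $i+l-1\ge\Delta(l)$; $\beta_{i,l}=0$ otherwise. For $i,l\ge1$: $\alpha_{i,l}=a_{\Delta^{ -1}(\lceil i+l-1\rceil_\Delta)-l,\ \delta(i+l-1),\ l-1}$ if $\Delta^{ -1}(\lceil i+l-1\rceil_\Delta)-l\ge\delta(i+l-1)$; otherwise $\alpha_{i,l}=1$ if $i+l-1$ is triangular and $i+l-1<\Delta(l)$; and $\alpha_{i,l}=0$ in all other cases. Deleting all edges of weight $0$ gives $D'$. Sources are $u_n=(\Delta(n),\Delta(n))$ and sinks $v_k=(0,\Delta(k))$. The weight $w(\mathcal{P})$ of a path is the product of its edge weights, and $\mathsf{P}_{n,k}$ is the set of directed paths in $D'$ from $u_n$ to $v_k$. -}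

module Defs where

open import Level using (Level)
open import Data.Nat using (ℕ; zero; suc; _+_; _∸_; _≤_; _<_; _≤?_; _<?_; _≟_; _≤ᵇ_; _≡ᵇ_)
open import Data.Bool using (Bool; true; false; if_then_else_)
open import Data.List using (List; []; _∷_; _++_; map; filter; foldr)
open import Data.Product using (_×_; _,_)
open import Relation.Nullary using (Dec; yes; no; ¬_)
open import Relation.Binary.PropositionalEquality using (_≡_)
open import Algebra.Bundles using (CommutativeRing)

Δ : ℕ → ℕ
Δ zero    = 0
Δ (suc n) = Δ n + suc n

leastFrom : ℕ → (ℕ → Bool) → ℕ → ℕ
leastFrom zero     P s = s
leastFrom (suc f) P s = if P s then s else leastFrom f P (suc s)

-- index of the smallest triangular number ≥ m (found among 0..m since Δ m ≥ m)
ceilIdx : ℕ → ℕ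
ceilIdx m = leastFrom m (λ n → m ≤ᵇ Δ n) 0

⌈_⌉Δ : ℕ → ℕ
⌈ m ⌉Δ = Δ (ceilIdx m)

δ : ℕ → ℕ
δ m = ⌈ m ⌉Δ ∸ m

isTri : ℕ → Bool
isTri t = Δ (ceilIdx t) ≡ᵇ t

-- Δ⁻¹ t : the unique n with Δ n = t (for triangular t; found among 0..t)
Δ⁻¹ : ℕ → ℕ
Δ⁻¹ t = leastFrom t (λ n → Δ n ≡ᵇ t) 0

data Wt : Set where
  wzero : Wt
  wone  : Wt
  wa    : ℕ → ℕ → ℕ → Wt
  we    : ℕ → ℕ → Wt

-- β_{i,l}  (used for i ≥ 1, l ≥ 0);  m = i + l - 1
β : ℕ → ℕ → Wt
β i l with i + l ∸ 1
... | m = if Δ l ≤ᵇ m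
            then (if isTri m then we (Δ⁻¹ m ∸ l) l else wone)
            else wzero

-- α_{i,l}  (used for i ≥ 1, l ≥ 1);  m = i + l - 1
α : ℕ → ℕ → Wt
α i l with i + l ∸ 1
... | m = if (l + δ m ≤ᵇ Δ⁻¹ ⌈ m ⌉Δ)
            then wa (Δ⁻¹ ⌈ m ⌉Δ ∸ l) (δ m) (l ∸ 1)
            else (if isTri m ∧' (suc m ≤ᵇ Δ l) then wone else wzero)
  where
  _∧'_ : Bool → Bool → Bool
  true  ∧' b = b
  false ∧' _ = false

-- an edge is present in D' iff its weight is not 0
data NZ : Wt → Set where
  nz1 : NZ wone
  nza : ∀ {i j l} → NZ (wa i j l)
  nze : ∀ {i l} → NZ (we i l)

nz? : (w : Wt) → Dec (NZ w)
nz? wzero      = no (λ ())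
nz? wone       = yes nz1
nz? (wa i j l) = yes nza
nz? (we i l)   = yes nze

-- Directed paths in D' from vertex (i , j) (0 ≤ i ≤ j) down to the row i = 0.
-- Every edge decreases the first coordinate by exactly one, so a maximal
-- path starting at (i , j) has exactly i edges and ends at some (0 , j').
--   hor  : edge (i+1 , j) → (i , j),        weight α_{i+1, j-(i+1)+1} = α_{i+1, j-i}
--   diag : edge (i+1 , j+1) → (i , j),      weight β_{i+1, (j+1)-(i+1)} = β_{i+1, j-i}

data Path : ℕ → ℕ → Set where
  stop : ∀ {j} → Path 0 j
  hor  : ∀ {i j} → suc i ≤ j → NZ (α (suc i) (j ∸ i)) → Path i j → Path (suc i) j
  diag : ∀ {i j} → i ≤ j → NZ (β (suc i) (j ∸ i)) → Path i j → Path (suc i) (suc j)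

end : ∀ {i j} → Path i j → ℕ
end {j = j} stop = j
end (hor _ _ p)  = end p
end (diag _ _ p) = end p

allPaths : (i j : ℕ) → List (Path i j)
allPaths zero j = stop ∷ []
allPaths (suc i) j = horPart j ++ diagPart j
  where
  horPart : (j : ℕ) → List (Path (suc i) j)
  horPart j with suc i ≤? j | nz? (α (suc i) (j ∸ i))
  ... | yes p | yes q = map (hor p q) (allPaths i j)
  ... | _     | _     = []
  diagPart : (j : ℕ) → List (Path (suc i) j)
  diagPart zero = []
  diagPart (suc j) with i ≤? j | nz? (β (suc i) (j ∸ i))
  ... | yes p | yes q = map (diag p q) (allPaths i j)
  ... | _     | _     = []

-- Specialised weights and path sums in an arbitrary commutative ring
-- (a polynomial identity over ℤ[a,c,e] is the same as an identity valid
--  for all elements a, c, e of all commutative rings).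

module _ {ℓ₁ ℓ₂ : Level} (R : CommutativeRing ℓ₁ ℓ₂) where
  open CommutativeRing R using (Carrier; 0#; 1#; -_) renaming (_+_ to _+R_; _*_ to _*R_)

  spec : (a c e : Carrier) → Wt → Carrier
  spec a c e wzero            = 0#
  spec a c e wone             = 1#
  spec a c e (wa i zero l)    = c
  spec a c e (wa i (suc j) l) = a
  spec a c e (we i l)         = e

  pathWeight : (a c e : Carrier) → ∀ {i j} → Path i j → Carrier
  pathWeight a c e stop = 1#
  pathWeight a c e (hor {i} {j} _ _ p)  = spec a c e (α (suc i) (j ∸ i)) *R pathWeight a c e p
  pathWeight a c e (diag {i} {j} _ _ p) = spec a c e (β (suc i) (j ∸ i)) *R pathWeight a c e p

  sumR : List Carrier → Carrier
  sumR = foldr _+R_ 0#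

  -- T(n,k) = Σ_{P ∈ P_{n,k}} w(P), paths from u_n = (Δ n , Δ n) to v_k = (0 , Δ k)
  pathSum : (a c e : Carrier) → ℕ → ℕ → Carrier
  pathSum a c e n k =
    sumR (map (pathWeight a c e) (filter (λ p → end p ≟ Δ k) (allPaths (Δ n) (Δ n))))

  _·ℕ_ : ℕ → Carrier → Carrier
  zero  ·ℕ x = 0#
  suc m ·ℕ x = x +R m ·ℕ x

  -- a·(n - k) with n - k an integer
  aTimesDiff : Carrier → ℕ → ℕ → Carrier
  aTimesDiff a n k with k ≤? n
  ... | yes _ = (n ∸ k) ·ℕ a
  ... | no  _ = - ((k ∸ n) ·ℕ a)

  Tmat : (a c e : Carrier) → ℕ → ℕ → Carrier
  Tmat a c e zero    zero    = 1#
  Tmat a c e zero    (suc k) = 0#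
  Tmat a c e (suc n) zero    = e *R Tmat a c e n zero
  Tmat a c e (suc n) (suc k) =
    (aTimesDiff a (suc n) (suc k) +R c) *R Tmat a c e n k +R e *R Tmat a c e n (suc k)

-- Every edge lowers the row by one, so the sums F(i, j, t) of the weights of the paths from
-- (i, j) to (0, t) satisfy a one-step recursion in the weights α, β of the two edges leaving
-- (i, j).  Write j = i + d and locate the column j among the triangular numbers.  The sum to
-- (0, Δ k) is T(p+1, k-d) when j = Δ(p+1+d), it is [m = k] when j = Δ m with m ≤ d, it is
-- e·((1 + a S)^(r-d) T)(b-d, k-d) when j = Δ b + r lies strictly inside a block with b ≥ d
-- (S shifting both indices by one), and it is 0 when b < d.  These closed forms hold on row 0
-- and survive the recursion, because T satisfies its defining recurrence and a(n-k) grows by a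
-- when k drops by one.  The source u_n = (Δ n, Δ n) is triangular with d = 0, so F = T(n, k).

module Submission where

open import Defs
open import Level using (Level)
open import Data.Nat
open import Data.Nat.Properties
open import Data.Bool using (Bool; true; false)
open import Data.List using (List; []; _∷_; _++_; map; filter)
open import Data.List.Properties using (map-++; map-∘; filter-++)
open import Function using (_∘_)
open import Data.Empty using (⊥-elim)
open import Relation.Nullary using (¬_; Dec; yes; no; does)
open import Relation.Unary using (Pred; Decidable)
open import Relation.Nullary.Decidable using (dec-true; dec-false)
open import Relation.Binary.Definitions using (tri<; tri≈; tri>)
open import Relation.Binary.PropositionalEquality using (_≡_; _≢_; refl; sym; trans; cong; cong₂; subst)
open import Algebra.Bundles using (CommutativeRing)

filter-map : ∀ {A B : Set} {ℓ : Level} {P : Pred B ℓ} (P? : Decidable P) (f : A → B) (xs : List A) →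
             filter P? (map f xs) ≡ map f (filter (P? ∘ f) xs)
filter-map P? f []       = refl
filter-map P? f (x ∷ xs) with does (P? (f x))
... | true  = cong (f x ∷_) (filter-map P? f xs)
... | false = filter-map P? f xs

≤ᵇ-true : ∀ {m n} → m ≤ n → (m ≤ᵇ n) ≡ true
≤ᵇ-true {m} {n} = dec-true (m ≤? n)

≤ᵇ-false : ∀ {m n} → ¬ m ≤ n → (m ≤ᵇ n) ≡ false
≤ᵇ-false {m} {n} = dec-false (m ≤? n)

≡ᵇ-true : ∀ {m n} → m ≡ n → (m ≡ᵇ n) ≡ true
≡ᵇ-true {m} {n} = dec-true (m ≟ n)

≡ᵇ-false : ∀ {m n} → m ≢ n → (m ≡ᵇ n) ≡ false
≡ᵇ-false {m} {n} = dec-false (m ≟ n)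

leastFrom≡ : ∀ f (P : ℕ → Bool) s t → s ≤ t → t ≤ f + s →
             (∀ n → s ≤ n → n < t → P n ≡ false) → P t ≡ true → leastFrom f P s ≡ t
leastFrom≡ zero    P s t s≤t t≤s _ _ = ≤-antisym s≤t t≤s
leastFrom≡ (suc f) P s t s≤t t≤f+s below Pt with s ≟ t
... | yes refl rewrite Pt = refl
... | no s≢t rewrite below s ≤-refl (≤∧≢⇒< s≤t s≢t) =
  leastFrom≡ f P (suc s) t (≤∧≢⇒< s≤t s≢t) (subst (t ≤_) (sym (+-suc f s)) t≤f+s)
    (λ n s<n n<t → below n (<⇒≤ s<n) n<t) Pt

Δ-mono-≤ : ∀ {m n} → m ≤ n → Δ m ≤ Δ n
Δ-mono-≤ {zero}  _           = z≤n
Δ-mono-≤ {suc m} (s≤s m≤n) = +-mono-≤ (Δ-mono-≤ m≤n) (s≤s m≤n)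

Δ<Δ+r : ∀ b {r} → 1 ≤ r → Δ b < Δ b + r
Δ<Δ+r b 1≤r = subst (_< Δ b + _) (+-identityʳ (Δ b)) (+-monoʳ-< (Δ b) 1≤r)

Δ-mono-< : ∀ {m n} → m < n → Δ m < Δ n
Δ-mono-< {m} {suc n} (s≤s m≤n) = ≤-<-trans (Δ-mono-≤ m≤n) (Δ<Δ+r n z<s)

Δ-injective : ∀ {m n} → Δ m ≡ Δ n → m ≡ n
Δ-injective {m} {n} eq with <-cmp m n
... | tri< m<n _ _ = ⊥-elim (<⇒≢ (Δ-mono-< m<n) eq)
... | tri≈ _ m≡n _ = m≡n
... | tri> _ _ n<m = ⊥-elim (<⇒≢ (Δ-mono-< n<m) (sym eq))

n≤Δn : ∀ n → n ≤ Δ n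
n≤Δn zero    = z≤n
n≤Δn (suc n) = m≤n+m (suc n) (Δ n)

Δ+r≢Δ : ∀ b {r} k → 1 ≤ r → r ≤ b → Δ b + r ≢ Δ k
Δ+r≢Δ b {r} k 1≤r r≤b eq with <-cmp k b
... | tri< k<b _ _ = <⇒≢ (≤-<-trans (Δ-mono-≤ (<⇒≤ k<b)) (Δ<Δ+r b 1≤r)) (sym eq)
... | tri≈ _ refl _ = <⇒≢ (Δ<Δ+r b 1≤r) (sym eq)
... | tri> _ _ b<k = <⇒≢ (<-≤-trans (+-monoʳ-< (Δ b) (s≤s r≤b)) (Δ-mono-≤ b<k)) eq

ceilIdx-Δ+r : ∀ b {r} → 1 ≤ r → r ≤ suc b → ceilIdx (Δ b + r) ≡ suc b
ceilIdx-Δ+r b {r} 1≤r r≤1+b =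
  leastFrom≡ (Δ b + r) (λ n → Δ b + r ≤ᵇ Δ n) 0 (suc b) z≤n
    (subst (suc b ≤_) (sym (+-identityʳ (Δ b + r)))
           (subst (_≤ Δ b + r) (+-comm b 1) (+-mono-≤ (n≤Δn b) 1≤r)))
    (λ n _ n<1+b → ≤ᵇ-false (<⇒≱ (≤-<-trans (Δ-mono-≤ (≤-pred n<1+b)) (Δ<Δ+r b 1≤r))))
    (≤ᵇ-true (+-monoʳ-≤ (Δ b) r≤1+b))

Δ⁻¹-Δ : ∀ m → Δ⁻¹ (Δ m) ≡ m
Δ⁻¹-Δ m = leastFrom≡ (Δ m) (λ n → Δ n ≡ᵇ Δ m) 0 m z≤n
  (subst (m ≤_) (sym (+-identityʳ (Δ m))) (n≤Δn m))
  (λ n _ n<m → ≡ᵇ-false (<⇒≢ (Δ-mono-< n<m))) (≡ᵇ-true {Δ m} refl)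

Δ⁻¹⌈Δ+r⌉ : ∀ b {r} → 1 ≤ r → r ≤ suc b → Δ⁻¹ ⌈ Δ b + r ⌉Δ ≡ suc b
Δ⁻¹⌈Δ+r⌉ b 1≤r r≤1+b rewrite ceilIdx-Δ+r b 1≤r r≤1+b = Δ⁻¹-Δ (suc b)

δ-Δ+r : ∀ b {r} → 1 ≤ r → r ≤ suc b → δ (Δ b + r) ≡ suc b ∸ r
δ-Δ+r b {r} 1≤r r≤1+b rewrite ceilIdx-Δ+r b 1≤r r≤1+b = [m+n]∸[m+o]≡n∸o (Δ b) (suc b) r

isTri-Δ : ∀ m → isTri (Δ m) ≡ true
isTri-Δ zero    = refl
isTri-Δ (suc b) rewrite ceilIdx-Δ+r b {suc b} (s≤s z≤n) ≤-refl = ≡ᵇ-true {Δ (suc b)} refl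

isTri-Δ+r : ∀ b {r} → 1 ≤ r → r ≤ b → isTri (Δ b + r) ≡ false
isTri-Δ+r b {r} 1≤r r≤b rewrite ceilIdx-Δ+r b 1≤r (m≤n⇒m≤1+n r≤b) =
  ≡ᵇ-false (λ eq → Δ+r≢Δ b (suc b) 1≤r r≤b (sym eq))

α-at-Δ : ∀ i l b → i + l ≡ Δ (suc b) → l ≤ suc b → α (suc i) l ≡ wa (suc b ∸ l) 0 (l ∸ 1)
α-at-Δ i l b eq l≤1+b
  rewrite eq | δ-Δ+r b {suc b} (s≤s z≤n) ≤-refl | n∸n≡0 b | Δ⁻¹⌈Δ+r⌉ b {suc b} (s≤s z≤n) ≤-refl
        | +-identityʳ l | ≤ᵇ-true l≤1+b = refl

α-at-Δ+r : ∀ i l b r → i + l ≡ Δ b + r → 1 ≤ r → r ≤ b → l ≤ r →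
           α (suc i) l ≡ wa (suc b ∸ l) (suc (b ∸ r)) (l ∸ 1)
α-at-Δ+r i l b r eq 1≤r r≤b l≤r
  rewrite eq | δ-Δ+r b 1≤r (m≤n⇒m≤1+n r≤b) | Δ⁻¹⌈Δ+r⌉ b 1≤r (m≤n⇒m≤1+n r≤b)
        | ≤ᵇ-true (≤-trans (+-monoˡ-≤ (suc b ∸ r) l≤r) (≤-reflexive (m+[n∸m]≡n (m≤n⇒m≤1+n r≤b))))
        | +-∸-assoc 1 r≤b = refl

α-at-low-Δ : ∀ i l m → i + l ≡ Δ (suc m) → suc m < l → α (suc i) l ≡ wone
α-at-low-Δ i l m eq m<l
  rewrite eq | δ-Δ+r m {suc m} (s≤s z≤n) ≤-refl | Δ⁻¹⌈Δ+r⌉ m {suc m} (s≤s z≤n) ≤-refl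
        | n∸n≡0 m | +-identityʳ l | ≤ᵇ-false {l} {suc m} (<⇒≱ m<l) | isTri-Δ (suc m)
        | ≤ᵇ-true (Δ-mono-< m<l) = refl

α-beyond-Δ+r : ∀ i l b r → i + l ≡ Δ b + r → 1 ≤ r → r ≤ b → r < l → α (suc i) l ≡ wzero
α-beyond-Δ+r i l b r eq 1≤r r≤b r<l
  rewrite eq | δ-Δ+r b 1≤r (m≤n⇒m≤1+n r≤b) | Δ⁻¹⌈Δ+r⌉ b 1≤r (m≤n⇒m≤1+n r≤b)
        | ≤ᵇ-false (λ q → <⇒≱ (+-monoˡ-< (suc b ∸ r) r<l)
                                (≤-trans q (≤-reflexive (sym (m+[n∸m]≡n (m≤n⇒m≤1+n r≤b))))))
        | isTri-Δ+r b 1≤r r≤b = refl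

β-at-Δ : ∀ i l m → i + l ≡ Δ m → Δ l ≤ Δ m → β (suc i) l ≡ we (m ∸ l) l
β-at-Δ i l m eq Δl≤Δm rewrite eq | ≤ᵇ-true Δl≤Δm | isTri-Δ m | Δ⁻¹-Δ m = refl

β-at-Δ+r : ∀ i l b r → i + l ≡ Δ b + r → 1 ≤ r → r ≤ b → Δ l ≤ Δ b + r → β (suc i) l ≡ wone
β-at-Δ+r i l b r eq 1≤r r≤b Δl≤ rewrite eq | ≤ᵇ-true Δl≤ | isTri-Δ+r b 1≤r r≤b = refl

β-below-Δ : ∀ i l → i + l < Δ l → β (suc i) l ≡ wzero
β-below-Δ i l i+l<Δl rewrite ≤ᵇ-false (<⇒≱ i+l<Δl) = refl

module _ {ℓ₁ ℓ₂ : Level} (R : CommutativeRing ℓ₁ ℓ₂) (a c e : CommutativeRing.Carrier R) where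

  open CommutativeRing R
    using (Carrier; 0#; 1#; -_; _≈_; setoid; +-cong; +-congˡ; +-congʳ; *-cong; *-congˡ; *-congʳ;
           zeroˡ; zeroʳ; distribˡ; -‿inverseʳ)
    renaming (_+_ to _+R_; _*_ to _*R_; refl to ≈-refl; sym to ≈-sym; trans to ≈-trans;
              reflexive to ≈-reflexive; +-identityˡ to +R-identityˡ; +-identityʳ to +R-identityʳ;
              *-identityˡ to *R-identityˡ; +-assoc to +R-assoc; +-comm to +R-comm)
  open import Algebra.Properties.Group (CommutativeRing.+-group R) using (inverseʳ-unique; ε⁻¹≈ε)
  open import Relation.Binary.Reasoning.Setoid setoid
  open import Data.Maybe using (nothing)
  open import Tactic.RingSolver.Core.AlmostCommutativeRing using (fromCommutativeRing)
  open import Tactic.RingSolver.NonReflective (fromCommutativeRing R (λ _ → nothing))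

  T : ℕ → ℕ → Carrier
  T = Tmat R a c e

  aTimesDiff-suc : ∀ n k → aTimesDiff R a (suc n) (suc k) ≈ aTimesDiff R a n k
  aTimesDiff-suc n k with k ≤? n | suc k ≤? suc n
  ... | yes _   | yes _   = ≈-refl
  ... | no _    | no _    = ≈-refl
  ... | yes k≤n | no ¬1+k≤1+n = ⊥-elim (¬1+k≤1+n (s≤s k≤n))
  ... | no ¬k≤n | yes 1+k≤1+n = ⊥-elim (¬k≤n (≤-pred 1+k≤1+n))

  -[a+x]+a≈-x : ∀ x → - (a +R x) +R a ≈ - x
  -[a+x]+a≈-x x = inverseʳ-unique x _ (begin
    x +R (- (a +R x) +R a)  ≈⟨ solve 3 (λ x n a → (x ⊕ (n ⊕ a)) ⊜ ((a ⊕ x) ⊕ n)) ≈-refl x (- (a +R x)) a ⟩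
    (a +R x) +R - (a +R x)  ≈⟨ -‿inverseʳ (a +R x) ⟩
    0#                      ∎)

  aTimesDiff-step : ∀ n k → aTimesDiff R a n k ≈ aTimesDiff R a n (suc k) +R a
  aTimesDiff-step n k with k ≤? n | suc k ≤? n
  ... | yes _   | yes k<n rewrite +-∸-assoc 1 k<n =
    +R-comm a (_·ℕ_ R (n ∸ suc k) a)
  ... | yes k≤n | no k≮n rewrite ≤-antisym k≤n (≮⇒≥ k≮n) | n∸n≡0 n | +-∸-assoc 1 (≤-refl {n}) | n∸n≡0 n =
    ≈-sym (≈-trans (-[a+x]+a≈-x 0#) ε⁻¹≈ε)
  ... | no k≰n  | yes k<n = ⊥-elim (k≰n (<⇒≤ k<n))
  ... | no k≰n  | no _ rewrite +-∸-assoc 1 (<⇒≤ (≰⇒> k≰n)) =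
    ≈-sym (-[a+x]+a≈-x (_·ℕ_ R (k ∸ n) a))

  record Recurrent (X : ℕ → ℕ → Carrier) (p : ℕ) : Set ℓ₂ where
    field
      at-zero : X (suc p) zero ≈ e *R X p zero
      at-suc  : ∀ q → X (suc p) (suc q) ≈ (aTimesDiff R a (suc p) (suc q) +R c) *R X p q +R e *R X p (suc q)
  open Recurrent

  T-recurrent : ∀ p → Recurrent T p
  T-recurrent p = record { at-zero = ≈-refl ; at-suc = λ q → ≈-refl }

  shiftBy : ℕ → (ℕ → Carrier) → ℕ → Carrier
  shiftBy zero    f k       = f k
  shiftBy (suc d) f zero    = 0#
  shiftBy (suc d) f (suc k) = shiftBy d f k

  diagShift : (ℕ → ℕ → Carrier) → ℕ → ℕ → Carrier
  diagShift X zero    q = 0#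
  diagShift X (suc p) q = shiftBy 1 (X p) q

  diagShift-at-zero : ∀ X p → diagShift X p zero ≡ 0#
  diagShift-at-zero X zero    = refl
  diagShift-at-zero X (suc p) = refl

  x*0+y*0≈0 : ∀ x y → x *R 0# +R y *R 0# ≈ 0#
  x*0+y*0≈0 x y = ≈-trans (+-cong (zeroʳ x) (zeroʳ y)) (+R-identityʳ 0#)

  diagShift-recurrent : ∀ {X p} → Recurrent X p → Recurrent (diagShift X) (suc p)
  at-zero (diagShift-recurrent {X} {p} rec) = ≈-sym (zeroʳ e)
  at-suc  (diagShift-recurrent {X} {p} rec) zero = begin
    X (suc p) 0                                                      ≈⟨ at-zero rec ⟩
    e *R X p 0                                                       ≈⟨ ≈-sym (+R-identityˡ _) ⟩
    0# +R e *R X p 0                                                 ≈⟨ +-congʳ (≈-sym (zeroʳ _)) ⟩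
    (aTimesDiff R a (2 + p) 1 +R c) *R 0# +R e *R X p 0              ∎
  at-suc  (diagShift-recurrent {X} {p} rec) (suc q) = begin
    X (suc p) (suc q)                                                ≈⟨ at-suc rec q ⟩
    (aTimesDiff R a (suc p) (suc q) +R c) *R X p q +R e *R X p (suc q)
      ≈⟨ +-congʳ (*-congʳ (+-congʳ (≈-sym (aTimesDiff-suc (suc p) (suc q))))) ⟩
    (aTimesDiff R a (2 + p) (2 + q) +R c) *R X p q +R e *R X p (suc q) ∎

  +a*-recurrent : ∀ {X Y p} → Recurrent X p → Recurrent Y p → Recurrent (λ p q → X p q +R a *R Y p q) p
  at-zero (+a*-recurrent {X} {Y} {p} recX recY) = begin
    X (suc p) 0 +R a *R Y (suc p) 0       ≈⟨ +-cong (at-zero recX) (*-congˡ (at-zero recY)) ⟩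
    e *R X p 0 +R a *R (e *R Y p 0)       ≈⟨ solve 4 (λ e a x y → (e ⊗ x ⊕ a ⊗ (e ⊗ y)) ⊜ (e ⊗ (x ⊕ a ⊗ y))) ≈-refl e a (X p 0) (Y p 0) ⟩
    e *R (X p 0 +R a *R Y p 0)            ∎
  at-suc (+a*-recurrent {X} {Y} {p} recX recY) q = begin
    X (suc p) (suc q) +R a *R Y (suc p) (suc q)
      ≈⟨ +-cong (at-suc recX q) (*-congˡ (at-suc recY q)) ⟩
    (K *R X p q +R e *R X p (suc q)) +R a *R (K *R Y p q +R e *R Y p (suc q))
      ≈⟨ solve 7 (λ K e a x x′ y y′ → ((K ⊗ x ⊕ e ⊗ x′) ⊕ a ⊗ (K ⊗ y ⊕ e ⊗ y′)) ⊜ (K ⊗ (x ⊕ a ⊗ y) ⊕ e ⊗ (x′ ⊕ a ⊗ y′)))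
                 ≈-refl K e a (X p q) (X p (suc q)) (Y p q) (Y p (suc q)) ⟩
    K *R (X p q +R a *R Y p q) +R e *R (X p (suc q) +R a *R Y p (suc q)) ∎
    where K = aTimesDiff R a (suc p) (suc q) +R c

  V : ℕ → ℕ → ℕ → Carrier
  V zero          = T
  V (suc j) p q   = V j p q +R a *R diagShift (V j) p q

  V-recurrent : ∀ {j p} → j ≤ p → Recurrent (V j) p
  V-recurrent {zero}  {p}     _           = T-recurrent p
  V-recurrent {suc j} {suc p} (s≤s j≤p) =
    +a*-recurrent (V-recurrent (m≤n⇒m≤1+n j≤p)) (diagShift-recurrent (V-recurrent j≤p))

  V-at-zero : ∀ j p → V j p zero ≈ T p zero
  V-at-zero zero    p = ≈-refl
  V-at-zero (suc j) p = begin
    V j p 0 +R a *R diagShift (V j) p 0  ≈⟨ +-cong (V-at-zero j p) (*-congˡ (≈-reflexive (diagShift-at-zero (V j) p))) ⟩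
    T p 0 +R a *R 0#                     ≈⟨ +-congˡ (zeroʳ a) ⟩
    T p 0 +R 0#                          ≈⟨ +R-identityʳ _ ⟩
    T p 0                                ∎

  T-step-identity-zero : ∀ p →
    (aTimesDiff R a p 0 +R c +R a) *R (e *R T p 0) +R e *R (aTimesDiff R a p 0 *R T p 0 +R e *R T p 1)
    ≈ aTimesDiff R a (suc p) 0 *R T (suc p) 0 +R e *R T (suc p) 1
  T-step-identity-zero p = begin
    (X +R c +R a) *R (e *R T p 0) +R e *R (X *R T p 0 +R e *R T p 1)
      ≈⟨ solve 6 (λ X c a e t₀ t₁ → ((X ⊕ c ⊕ a) ⊗ (e ⊗ t₀) ⊕ e ⊗ (X ⊗ t₀ ⊕ e ⊗ t₁))
                                   ⊜ ((X ⊕ a) ⊗ (e ⊗ t₀) ⊕ e ⊗ ((X ⊕ c) ⊗ t₀ ⊕ e ⊗ t₁)))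
               ≈-refl X c a e (T p 0) (T p 1) ⟩
    (X +R a) *R (e *R T p 0) +R e *R ((X +R c) *R T p 0 +R e *R T p 1)
      ≈⟨ +-cong (*-congʳ (≈-sym (≈-trans (aTimesDiff-step (suc p) 0) (+-congʳ (aTimesDiff-suc p 0)))))
                (*-congˡ (+-congʳ (*-congʳ (+-congʳ (≈-sym (aTimesDiff-suc p 0)))))) ⟩
    aTimesDiff R a (suc p) 0 *R (e *R T p 0) +R e *R ((aTimesDiff R a (suc p) 1 +R c) *R T p 0 +R e *R T p 1) ∎
    where X = aTimesDiff R a p 0

  T-step-identity-suc : ∀ p q →
    (aTimesDiff R a p (suc q) +R c +R a) *R (aTimesDiff R a p q *R T p q +R e *R T p (suc q))
      +R e *R (aTimesDiff R a p (suc q) *R T p (suc q) +R e *R T p (2 + q))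
    ≈ aTimesDiff R a (suc p) (suc q) *R T (suc p) (suc q) +R e *R T (suc p) (2 + q)
  T-step-identity-suc p q = begin
    (X +R c +R a) *R (aTimesDiff R a p q *R t₀ +R e *R t₁) +R e *R (X *R t₁ +R e *R t₂)
      ≈⟨ +-congʳ (*-congˡ (+-congʳ (*-congʳ (aTimesDiff-step p q)))) ⟩
    (X +R c +R a) *R ((X +R a) *R t₀ +R e *R t₁) +R e *R (X *R t₁ +R e *R t₂)
      ≈⟨ solve 7 (λ X c a e t₀ t₁ t₂ → ((X ⊕ c ⊕ a) ⊗ ((X ⊕ a) ⊗ t₀ ⊕ e ⊗ t₁) ⊕ e ⊗ (X ⊗ t₁ ⊕ e ⊗ t₂))
                                       ⊜ ((X ⊕ a) ⊗ (((X ⊕ a) ⊕ c) ⊗ t₀ ⊕ e ⊗ t₁) ⊕ e ⊗ ((X ⊕ c) ⊗ t₁ ⊕ e ⊗ t₂)))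
               ≈-refl X c a e t₀ t₁ t₂ ⟩
    (X +R a) *R ((X +R a +R c) *R t₀ +R e *R t₁) +R e *R ((X +R c) *R t₁ +R e *R t₂)
      ≈⟨ +-cong (*-cong X+a≈ (+-congʳ (*-congʳ (+-congʳ X+a≈))))
                (*-congˡ (+-congʳ (*-congʳ (+-congʳ (≈-sym (aTimesDiff-suc p (suc q))))))) ⟩
    aTimesDiff R a (suc p) (suc q) *R T (suc p) (suc q) +R e *R T (suc p) (2 + q) ∎
    where
    X = aTimesDiff R a p (suc q)
    t₀ = T p q
    t₁ = T p (suc q)
    t₂ = T p (2 + q)
    X+a≈ : X +R a ≈ aTimesDiff R a (suc p) (suc q)
    X+a≈ = ≈-trans (≈-sym (aTimesDiff-step p q)) (≈-sym (aTimesDiff-suc p q))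

  e*V-diagonal : ∀ p q → e *R V p p (suc q) ≈ aTimesDiff R a p q *R T p q +R e *R T p (suc q)
  e*V-diagonal zero    zero    = ≈-trans (zeroʳ e) (≈-sym (≈-trans (+-cong (zeroˡ 1#) (zeroʳ e)) (+R-identityʳ 0#)))
  e*V-diagonal zero    (suc q) = ≈-trans (zeroʳ e) (≈-sym (x*0+y*0≈0 _ e))
  e*V-diagonal (suc p) q       = begin
    e *R (V p (suc p) (suc q) +R a *R V p p q)
      ≈⟨ *-congˡ (+-congʳ (at-suc (V-recurrent ≤-refl) q)) ⟩
    e *R ((aTimesDiff R a (suc p) (suc q) +R c) *R V p p q +R e *R V p p (suc q) +R a *R V p p q)
      ≈⟨ *-congˡ (+-congʳ (+-congʳ (*-congʳ (+-congʳ (aTimesDiff-suc p q))))) ⟩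
    e *R ((X +R c) *R V p p q +R e *R V p p (suc q) +R a *R V p p q)
      ≈⟨ solve 6 (λ e X c a v u → (e ⊗ ((X ⊕ c) ⊗ v ⊕ e ⊗ u ⊕ a ⊗ v)) ⊜ ((X ⊕ c ⊕ a) ⊗ (e ⊗ v) ⊕ e ⊗ (e ⊗ u)))
               ≈-refl e X c a (V p p q) (V p p (suc q)) ⟩
    (X +R c +R a) *R (e *R V p p q) +R e *R (e *R V p p (suc q))
      ≈⟨ +-congˡ (*-congˡ (e*V-diagonal p q)) ⟩
    (X +R c +R a) *R (e *R V p p q) +R e *R (X *R T p q +R e *R T p (suc q))
      ≈⟨ lower-diagonal q ⟩
    aTimesDiff R a (suc p) q *R T (suc p) q +R e *R T (suc p) (suc q) ∎
    where
    X = aTimesDiff R a p q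
    lower-diagonal : ∀ q → (aTimesDiff R a p q +R c +R a) *R (e *R V p p q)
                             +R e *R (aTimesDiff R a p q *R T p q +R e *R T p (suc q))
                           ≈ aTimesDiff R a (suc p) q *R T (suc p) q +R e *R T (suc p) (suc q)
    lower-diagonal zero    = ≈-trans (+-congʳ (*-congˡ (*-congˡ (V-at-zero p p)))) (T-step-identity-zero p)
    lower-diagonal (suc q) = ≈-trans (+-congʳ (*-congˡ (e*V-diagonal p q))) (T-step-identity-suc p q)

  T-suc : ∀ p q → T (suc p) q ≈ c *R shiftBy 1 (T p) q +R e *R V p p q
  T-suc p zero = begin
    e *R T p 0                 ≈⟨ *-congˡ (≈-sym (V-at-zero p p)) ⟩
    e *R V p p 0               ≈⟨ ≈-sym (+R-identityˡ _) ⟩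
    0# +R e *R V p p 0         ≈⟨ +-congʳ (≈-sym (zeroʳ c)) ⟩
    c *R 0# +R e *R V p p 0    ∎
  T-suc p (suc q) = begin
    (aTimesDiff R a (suc p) (suc q) +R c) *R T p q +R e *R T p (suc q)
      ≈⟨ +-congʳ (*-congʳ (+-congʳ (aTimesDiff-suc p q))) ⟩
    (aTimesDiff R a p q +R c) *R T p q +R e *R T p (suc q)
      ≈⟨ solve 5 (λ x c t e u → ((x ⊕ c) ⊗ t ⊕ e ⊗ u) ⊜ (c ⊗ t ⊕ (x ⊗ t ⊕ e ⊗ u)))
               ≈-refl (aTimesDiff R a p q) c (T p q) e (T p (suc q)) ⟩
    c *R T p q +R (aTimesDiff R a p q *R T p q +R e *R T p (suc q))
      ≈⟨ +-congˡ (≈-sym (e*V-diagonal p q)) ⟩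
    c *R T p q +R e *R V p p (suc q) ∎

  shiftBy-T-suc : ∀ p d k → shiftBy d (T (suc p)) k ≈ c *R shiftBy (suc d) (T p) k +R e *R shiftBy d (V p p) k
  shiftBy-T-suc p zero    k       = T-suc p k
  shiftBy-T-suc p (suc d) zero    = ≈-sym (x*0+y*0≈0 c e)
  shiftBy-T-suc p (suc d) (suc k) = shiftBy-T-suc p d k

  shiftBy-V-suc : ∀ j p d k → shiftBy d (V (suc j) (suc p)) k ≈ shiftBy d (V j (suc p)) k +R a *R shiftBy (suc d) (V j p) k
  shiftBy-V-suc j p zero    k       = ≈-refl
  shiftBy-V-suc j p (suc d) zero    = ≈-sym (≈-trans (+-congˡ (zeroʳ a)) (+R-identityʳ 0#))
  shiftBy-V-suc j p (suc d) (suc k) = shiftBy-V-suc j p d k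

  sumR-++ : ∀ xs ys → sumR R (xs ++ ys) ≈ sumR R xs +R sumR R ys
  sumR-++ []       ys = ≈-sym (+R-identityˡ _)
  sumR-++ (x ∷ xs) ys = ≈-trans (+-congˡ (sumR-++ xs ys)) (≈-sym (+R-assoc _ _ _))

  sumR-scale : ∀ {A : Set} k (f : A → Carrier) xs → sumR R (map (λ x → k *R f x) xs) ≈ k *R sumR R (map f xs)
  sumR-scale k f []       = ≈-sym (zeroʳ k)
  sumR-scale k f (x ∷ xs) = ≈-trans (+-congˡ (sumR-scale k f xs)) (≈-sym (distribˡ k _ _))

  weight : Wt → Carrier
  weight = spec R a c e

  weight-absent : ∀ x → ¬ NZ x → ∀ y → 0# ≈ weight x *R y
  weight-absent wzero      _   y = ≈-sym (zeroˡ y)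
  weight-absent wone       ¬nz _ = ⊥-elim (¬nz nz1)
  weight-absent (wa _ _ _) ¬nz _ = ⊥-elim (¬nz nza)
  weight-absent (we _ _)   ¬nz _ = ⊥-elim (¬nz nze)

  endsAt : (t : ℕ) → ∀ {i j} (P : Path i j) → Dec (end P ≡ t)
  endsAt t P = end P ≟ t

  sumEndingAt : ℕ → ∀ {i j} → List (Path i j) → Carrier
  sumEndingAt t xs = sumR R (map (pathWeight R a c e) (filter (endsAt t) xs))

  sumEndingAt-++ : ∀ t {i j} (xs ys : List (Path i j)) → sumEndingAt t (xs ++ ys) ≈ sumEndingAt t xs +R sumEndingAt t ys
  sumEndingAt-++ t xs ys
    rewrite filter-++ (endsAt t) xs ys
          | map-++ (pathWeight R a c e) (filter (endsAt t) xs) (filter (endsAt t) ys) =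
    sumR-++ (map (pathWeight R a c e) (filter (endsAt t) xs)) (map (pathWeight R a c e) (filter (endsAt t) ys))

  sumEndingAt-hor : ∀ t {i j} (i<j : suc i ≤ j) nz (xs : List (Path i j)) →
                    sumEndingAt t (map (hor i<j nz) xs) ≈ weight (α (suc i) (j ∸ i)) *R sumEndingAt t xs
  sumEndingAt-hor t {i} {j} i<j nz xs
    rewrite filter-map (endsAt t) (hor i<j nz) xs
          | sym (map-∘ {g = pathWeight R a c e} {f = hor i<j nz} (filter (endsAt t) xs)) =
    sumR-scale (weight (α (suc i) (j ∸ i))) (pathWeight R a c e) (filter (endsAt t) xs)

  sumEndingAt-diag : ∀ t {i j} (i≤j : i ≤ j) nz (xs : List (Path i j)) →
                     sumEndingAt t (map (diag i≤j nz) xs) ≈ weight (β (suc i) (j ∸ i)) *R sumEndingAt t xs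
  sumEndingAt-diag t {i} {j} i≤j nz xs
    rewrite filter-map (endsAt t) (diag i≤j nz) xs
          | sym (map-∘ {g = pathWeight R a c e} {f = diag i≤j nz} (filter (endsAt t) xs)) =
    sumR-scale (weight (β (suc i) (j ∸ i))) (pathWeight R a c e) (filter (endsAt t) xs)

  sumPaths : ℕ → ℕ → ℕ → Carrier
  sumPaths i j t = sumEndingAt t (allPaths i j)

  sumPaths-step : ∀ i j t → i ≤ j →
    sumPaths (suc i) (suc j) t ≈ weight (α (suc i) (suc j ∸ i)) *R sumPaths i (suc j) t
                                  +R weight (β (suc i) (j ∸ i)) *R sumPaths i j t
  sumPaths-step i j t i≤j with suc i ≤? suc j | nz? (α (suc i) (suc j ∸ i)) | i ≤? j | nz? (β (suc i) (j ∸ i))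
  ... | no ¬i<j | _     | _      | _ = ⊥-elim (¬i<j (s≤s i≤j))
  ... | yes _   | _     | no ¬i≤j | _ = ⊥-elim (¬i≤j i≤j)
  ... | yes i<j | yes h | yes i≤j | yes d = ≈-trans (sumEndingAt-++ t (map (hor i<j h) (allPaths i (suc j))) (map (diag i≤j d) (allPaths i j)))
        (+-cong (sumEndingAt-hor t i<j h (allPaths i (suc j))) (sumEndingAt-diag t i≤j d (allPaths i j)))
  ... | yes _   | no ¬h | yes i≤j | yes d = ≈-trans (sumEndingAt-++ t [] (map (diag i≤j d) (allPaths i j)))
        (+-cong (weight-absent _ ¬h _) (sumEndingAt-diag t i≤j d (allPaths i j)))
  ... | yes i<j | yes h | yes _  | no ¬d = ≈-trans (sumEndingAt-++ t (map (hor i<j h) (allPaths i (suc j))) [])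
        (+-cong (sumEndingAt-hor t i<j h (allPaths i (suc j))) (weight-absent _ ¬d _))
  ... | yes _   | no ¬h | yes _  | no ¬d = ≈-trans (sumEndingAt-++ t {suc i} {suc j} [] [])
        (+-cong (weight-absent _ ¬h _) (weight-absent _ ¬d _))

  sumPaths-row0-≡ : ∀ j → sumPaths 0 j j ≈ 1#
  sumPaths-row0-≡ j rewrite ≡ᵇ-true {j} refl = +R-identityʳ 1#

  sumPaths-row0-≢ : ∀ j t → j ≢ t → sumPaths 0 j t ≈ 0#
  sumPaths-row0-≢ j t j≢t rewrite ≡ᵇ-false j≢t = ≈-refl

  sumPaths-step′ : ∀ i d t →
    sumPaths (suc i) (suc i + d) t ≈ weight (α (suc i) (suc d)) *R sumPaths i (i + suc d) t
                                      +R weight (β (suc i) d) *R sumPaths i (i + d) t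
  sumPaths-step′ i d t = begin
    sumPaths (suc i) (suc (i + d)) t
      ≈⟨ sumPaths-step i (i + d) t (m≤m+n i d) ⟩
    weight (α (suc i) (suc (i + d) ∸ i)) *R sumPaths i (suc (i + d)) t +R weight (β (suc i) (i + d ∸ i)) *R sumPaths i (i + d) t
      ≡⟨ cong₂ (λ l l′ → weight (α (suc i) l) *R sumPaths i (suc (i + d)) t +R weight (β (suc i) l′) *R sumPaths i (i + d) t)
               (trans (cong (_∸ i) (sym (+-suc i d))) (m+n∸m≡n i (suc d))) (m+n∸m≡n i d) ⟩
    weight (α (suc i) (suc d)) *R sumPaths i (suc (i + d)) t +R weight (β (suc i) d) *R sumPaths i (i + d) t
      ≡⟨ cong (λ j → weight (α (suc i) (suc d)) *R sumPaths i j t +R weight (β (suc i) d) *R sumPaths i (i + d) t)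
              (sym (+-suc i d)) ⟩
    weight (α (suc i) (suc d)) *R sumPaths i (i + suc d) t +R weight (β (suc i) d) *R sumPaths i (i + d) t ∎

  record ClosedForms (i : ℕ) : Set ℓ₂ where
    field
      triangular-near : ∀ p d k → i + d ≡ Δ (suc p + d) →
                        sumPaths i (i + d) (Δ k) ≈ shiftBy d (T (suc p)) k
      triangular-far  : ∀ m d k → m ≤ d → i + d ≡ Δ m →
                        sumPaths i (i + d) (Δ k) ≈ shiftBy m (T 0) k
      interior-near   : ∀ b r p d k → 1 ≤ r → r ≤ b → b ≡ d + p → i + d ≡ Δ b + r →
                        sumPaths i (i + d) (Δ k) ≈ e *R shiftBy d (V (r ∸ d) p) k
      interior-far    : ∀ b r d k → 1 ≤ r → r ≤ b → b < d → i + d ≡ Δ b + r →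
                        sumPaths i (i + d) (Δ k) ≈ 0#
  open ClosedForms

  triangular : ∀ {i} → ClosedForms i → ∀ p d k → i + d ≡ Δ (p + d) → sumPaths i (i + d) (Δ k) ≈ shiftBy d (T p) k
  triangular I zero    d k eq = triangular-far I d d k ≤-refl eq
  triangular I (suc p) d k eq = triangular-near I p d k eq

  shiftBy-T0-≡ : ∀ m → shiftBy m (T 0) m ≡ 1#
  shiftBy-T0-≡ zero    = refl
  shiftBy-T0-≡ (suc m) = shiftBy-T0-≡ m

  shiftBy-T0-≢ : ∀ m k → m ≢ k → shiftBy m (T 0) k ≡ 0#
  shiftBy-T0-≢ zero    zero    m≢k = ⊥-elim (m≢k refl)
  shiftBy-T0-≢ zero    (suc k) _   = refl
  shiftBy-T0-≢ (suc m) zero    _   = refl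
  shiftBy-T0-≢ (suc m) (suc k) m≢k = shiftBy-T0-≢ m k (m≢k ∘ cong suc)

  closedForms-0 : ClosedForms 0
  triangular-near closedForms-0 p d k eq = ⊥-elim (<⇒≢ (<-≤-trans (m<n+m d z<s) (n≤Δn (suc p + d))) eq)
  triangular-far  closedForms-0 m .(Δ m) k _ refl with k ≟ m
  ... | yes refl = ≈-trans (sumPaths-row0-≡ (Δ k)) (≈-reflexive (sym (shiftBy-T0-≡ k)))
  ... | no k≢m   = ≈-trans (sumPaths-row0-≢ (Δ m) (Δ k) (k≢m ∘ sym ∘ Δ-injective))
                           (≈-reflexive (sym (shiftBy-T0-≢ m k (k≢m ∘ sym))))
  interior-near   closedForms-0 b r p d k 1≤r _ refl eq =
    ⊥-elim (<⇒≢ (≤-<-trans (≤-trans (m≤m+n d p) (n≤Δn (d + p))) (Δ<Δ+r (d + p) 1≤r)) eq)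
  interior-far    closedForms-0 b r .(Δ b + r) k 1≤r r≤b _ refl = sumPaths-row0-≢ (Δ b + r) (Δ k) (Δ+r≢Δ b k 1≤r r≤b)

  module _ {i : ℕ} (I : ClosedForms i) where

    diagonal-term : ∀ b r p d k → r ≤ b → b ≡ d + p → i + d ≡ Δ b + r →
                    weight (β (suc i) d) *R sumPaths i (i + d) (Δ k) ≈ e *R shiftBy d (V (r ∸ d) p) k
    diagonal-term b zero p d k _ refl eq rewrite 0∸n≡0 d =
      *-cong (≈-reflexive (cong weight (β-at-Δ i d (d + p) eq′ (Δ-mono-≤ (m≤m+n d p)))))
             (triangular I p d k (trans eq′ (cong Δ (+-comm d p))))
      where eq′ = trans eq (+-identityʳ _)
    diagonal-term b (suc r) p d k r<b refl eq = begin
      weight (β (suc i) d) *R sumPaths i (i + d) (Δ k)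
        ≈⟨ *-cong (≈-reflexive (cong weight (β-at-Δ+r i d b (suc r) eq (s≤s z≤n) r<b Δd≤)))
                  (interior-near I b (suc r) p d k (s≤s z≤n) r<b refl eq) ⟩
      1# *R (e *R shiftBy d (V (suc r ∸ d) p) k)   ≈⟨ *R-identityˡ _ ⟩
      e *R shiftBy d (V (suc r ∸ d) p) k           ∎
      where Δd≤ = ≤-trans (Δ-mono-≤ (m≤m+n d p)) (m≤m+n (Δ b) (suc r))

    triangular-near-suc : ∀ p d k → suc i + d ≡ Δ (suc p + d) →
                          sumPaths (suc i) (suc i + d) (Δ k) ≈ shiftBy d (T (suc p)) k
    triangular-near-suc p d k eq = begin
      sumPaths (suc i) (suc i + d) (Δ k)
        ≈⟨ sumPaths-step′ i d (Δ k) ⟩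
      weight (α (suc i) (suc d)) *R sumPaths i (i + suc d) (Δ k) +R weight (β (suc i) d) *R sumPaths i (i + d) (Δ k)
        ≈⟨ +-cong (*-cong (≈-reflexive (cong weight (α-at-Δ i (suc d) (p + d) (trans (+-suc i d) eq) (s≤s (m≤n+m d p)))))
                          (triangular I p (suc d) k (trans (+-suc i d) (trans eq (cong Δ (sym (+-suc p d)))))))
                  (diagonal-term (p + d) (p + d) p d k ≤-refl (+-comm p d) (suc-injective (trans eq (+-suc _ _)))) ⟩
      c *R shiftBy (suc d) (T p) k +R e *R shiftBy d (V (p + d ∸ d) p) k
        ≡⟨ cong (λ j → c *R shiftBy (suc d) (T p) k +R e *R shiftBy d (V j p) k) (m+n∸n≡m p d) ⟩
      c *R shiftBy (suc d) (T p) k +R e *R shiftBy d (V p p) k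
        ≈⟨ ≈-sym (shiftBy-T-suc p d k) ⟩
      shiftBy d (T (suc p)) k ∎

    triangular-far-suc : ∀ m d k → m ≤ d → suc i + d ≡ Δ m → sumPaths (suc i) (suc i + d) (Δ k) ≈ shiftBy m (T 0) k
    triangular-far-suc (suc b) d k m≤d eq = begin
      sumPaths (suc i) (suc i + d) (Δ k)
        ≈⟨ sumPaths-step′ i d (Δ k) ⟩
      weight (α (suc i) (suc d)) *R sumPaths i (i + suc d) (Δ k) +R weight (β (suc i) d) *R sumPaths i (i + d) (Δ k)
        ≈⟨ +-cong (*-cong (≈-reflexive (cong weight (α-at-low-Δ i (suc d) b (trans (+-suc i d) eq) (s≤s m≤d))))
                          (triangular-far I (suc b) (suc d) k (m≤n⇒m≤1+n m≤d) (trans (+-suc i d) eq)))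
                  (*-congʳ (≈-reflexive (cong weight (β-below-Δ i d (≤-trans (≤-reflexive eq) (Δ-mono-≤ m≤d)))))) ⟩
      1# *R shiftBy (suc b) (T 0) k +R 0# *R sumPaths i (i + d) (Δ k)
        ≈⟨ +-cong (*R-identityˡ _) (zeroˡ _) ⟩
      shiftBy (suc b) (T 0) k +R 0#
        ≈⟨ +R-identityʳ _ ⟩
      shiftBy (suc b) (T 0) k ∎

    interior-far-suc : ∀ b r d k → 1 ≤ r → r ≤ b → b < d → suc i + d ≡ Δ b + r →
                       sumPaths (suc i) (suc i + d) (Δ k) ≈ 0#
    interior-far-suc b r d k 1≤r r≤b b<d eq = begin
      sumPaths (suc i) (suc i + d) (Δ k)
        ≈⟨ sumPaths-step′ i d (Δ k) ⟩
      weight (α (suc i) (suc d)) *R sumPaths i (i + suc d) (Δ k) +R weight (β (suc i) d) *R sumPaths i (i + d) (Δ k)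
        ≈⟨ +-cong (*-congʳ (≈-reflexive (cong weight (α-beyond-Δ+r i (suc d) b r (trans (+-suc i d) eq) 1≤r r≤b r<1+d))))
                  (*-congʳ (≈-reflexive (cong weight (β-below-Δ i d i+d<Δd)))) ⟩
      0# *R sumPaths i (i + suc d) (Δ k) +R 0# *R sumPaths i (i + d) (Δ k)
        ≈⟨ +-cong (zeroˡ _) (zeroˡ _) ⟩
      0# +R 0#
        ≈⟨ +R-identityʳ 0# ⟩
      0# ∎
      where
      r<1+d = s≤s (≤-trans r≤b (<⇒≤ b<d))
      i+d<Δd = ≤-trans (≤-reflexive eq) (≤-trans (+-monoʳ-≤ (Δ b) (m≤n⇒m≤1+n r≤b)) (Δ-mono-≤ b<d))

    interior-near-suc : ∀ b r p d k → 1 ≤ r → r ≤ b → b ≡ d + p → suc i + d ≡ Δ b + r →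
                        sumPaths (suc i) (suc i + d) (Δ k) ≈ e *R shiftBy d (V (r ∸ d) p) k
    interior-near-suc b (suc r) p d k 1≤r r<b b≡d+p eq with suc d ≤? suc r | p
    ... | yes d<r | zero   = ⊥-elim (<⇒≱ d<r (≤-trans r<b (≤-reflexive (trans b≡d+p (+-identityʳ d)))))
    ... | yes d<r | suc p′ = begin
      sumPaths (suc i) (suc i + d) (Δ k)
        ≈⟨ sumPaths-step′ i d (Δ k) ⟩
      weight (α (suc i) (suc d)) *R sumPaths i (i + suc d) (Δ k) +R weight (β (suc i) d) *R sumPaths i (i + d) (Δ k)
        ≈⟨ +-cong (*-cong (≈-reflexive (cong weight (α-at-Δ+r i (suc d) b (suc r) (trans (+-suc i d) eq) 1≤r r<b d<r)))
                          (interior-near I b (suc r) p′ (suc d) k 1≤r r<b (trans b≡d+p (+-suc d p′)) (trans (+-suc i d) eq)))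
                  (diagonal-term b r (suc p′) d k (<⇒≤ r<b) b≡d+p eq′) ⟩
      a *R (e *R shiftBy (suc d) (V (r ∸ d) p′) k) +R e *R shiftBy d (V (r ∸ d) (suc p′)) k
        ≈⟨ solve 4 (λ a e x y → (a ⊗ (e ⊗ x) ⊕ e ⊗ y) ⊜ (e ⊗ (y ⊕ a ⊗ x))) ≈-refl a e _ _ ⟩
      e *R (shiftBy d (V (r ∸ d) (suc p′)) k +R a *R shiftBy (suc d) (V (r ∸ d) p′) k)
        ≈⟨ *-congˡ (≈-sym (shiftBy-V-suc (r ∸ d) p′ d k)) ⟩
      e *R shiftBy d (V (suc (r ∸ d)) (suc p′)) k
        ≡⟨ cong (λ j → e *R shiftBy d (V j (suc p′)) k) (sym (+-∸-assoc 1 (≤-pred d<r))) ⟩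
      e *R shiftBy d (V (suc r ∸ d) (suc p′)) k ∎
      where eq′ = suc-injective (trans eq (+-suc (Δ b) r))
    ... | no r≤d  | p      = begin
      sumPaths (suc i) (suc i + d) (Δ k)
        ≈⟨ sumPaths-step′ i d (Δ k) ⟩
      weight (α (suc i) (suc d)) *R sumPaths i (i + suc d) (Δ k) +R weight (β (suc i) d) *R sumPaths i (i + d) (Δ k)
        ≈⟨ +-cong (*-congʳ (≈-reflexive (cong weight (α-beyond-Δ+r i (suc d) b (suc r) (trans (+-suc i d) eq) 1≤r r<b (s≤s (≮⇒≥ r≤d))))))
                  (diagonal-term b r p d k (<⇒≤ r<b) b≡d+p eq′) ⟩
      0# *R sumPaths i (i + suc d) (Δ k) +R e *R shiftBy d (V (r ∸ d) p) k
        ≈⟨ ≈-trans (+-congʳ (zeroˡ _)) (+R-identityˡ _) ⟩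
      e *R shiftBy d (V (r ∸ d) p) k
        ≡⟨ cong (λ j → e *R shiftBy d (V j p) k) (trans (m≤n⇒m∸n≡0 (<⇒≤ r<d)) (sym (m≤n⇒m∸n≡0 r<d))) ⟩
      e *R shiftBy d (V (suc r ∸ d) p) k ∎
      where
      eq′ = suc-injective (trans eq (+-suc (Δ b) r))
      r<d = ≮⇒≥ r≤d

  closedForms-suc : ∀ {i} → ClosedForms i → ClosedForms (suc i)
  closedForms-suc I = record
    { triangular-near = triangular-near-suc I
    ; triangular-far  = triangular-far-suc I
    ; interior-near   = interior-near-suc I
    ; interior-far    = interior-far-suc I
    }

  closedForms : ∀ i → ClosedForms i
  closedForms zero    = closedForms-0
  closedForms (suc i) = closedForms-suc (closedForms i)

  pathSum≈Tmat : ∀ n k → pathSum R a c e n k ≈ T n k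
  pathSum≈Tmat n k = begin
    sumPaths (Δ n) (Δ n) (Δ k)      ≡⟨ cong (λ j → sumPaths (Δ n) j (Δ k)) (sym (+-identityʳ (Δ n))) ⟩
    sumPaths (Δ n) (Δ n + 0) (Δ k)  ≈⟨ triangular (closedForms (Δ n)) n 0 k (trans (+-identityʳ (Δ n)) (cong Δ (sym (+-identityʳ n)))) ⟩
    T n k                           ∎

theorem3p2 : ∀ {ℓ₁ ℓ₂ : Level} (R : CommutativeRing ℓ₁ ℓ₂)
    (a c e : CommutativeRing.Carrier R) (n k : ℕ) →
    CommutativeRing._≈_ R (pathSum R a c e n k) (Tmat R a c e n k)
theorem3p2 R a c e n k = pathSum≈Tmat R a c e n k
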